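{- Let $H$ be a finite connected bipartite graph and let $St(H)$ be its star-studded graph. Then there is a bijection between the set of minimum vertex covers of $H$ and the set of minimum vertex covers of $St(H)$.
   Context: Let $3\star$ denote the star $K_{1,3}$ (a center with three leaves). $St(H)$ is the graph obtained from $H$ by attaching a copy of $3\star$ to every vertex $x$ of $H$, where attaching means identifying $x$ with one leaf of a new copy of $3\star$; equivalently, for each vertex $x$ of $H$ one adds a new vertex $c_x$ adjacent to $x$ and two new vertices of degree one adjacent to $c_x$. A vertex cover is a set of vertices meeting every edge; it is minimum if it has the smallest possible cardinality. -}

module Defs where

open import Data.Nat using (ℕ; _*_; _≤_)
open import Data.Bool using (Bool; true; false; _∧_; _∨_)
open import Data.Fin using (Fin; zero; suc; remQuot; _≟_)
open import Data.Fin.Subset using (Subset; _∈_; ∣_∣)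
open import Data.Product using (Σ; Σ-syntax; ∃; _×_; _,_; proj₁)
open import Data.Sum using (_⊎_)
open import Relation.Nullary using (¬_; does)
open import Relation.Binary.PropositionalEquality using (_≡_; _≢_)

record Graph : Set where
  constructor graph
  field
    n   : ℕ
    adj : Fin n → Fin n → Bool
open Graph public

Edge : (G : Graph) → Fin (n G) → Fin (n G) → Set
Edge G u v = adj G u v ≡ true

IsSimple : Graph → Set
IsSimple G = (∀ u v → adj G u v ≡ adj G v u) × (∀ u → adj G u u ≡ false)

data Walk (G : Graph) : Fin (n G) → Fin (n G) → Set where
  [] : ∀ {u} → Walk G u u
  _∷_ : ∀ {u v w} → Edge G u v → Walk G v w → Walk G u w

Connected : Graph → Set
Connected G = ∀ u v → Walk G u v

Bipartite : Graph → Set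
Bipartite G = Σ[ c ∈ (Fin (n G) → Bool) ] (∀ u v → Edge G u v → c u ≢ c v)

IsVertexCover : (G : Graph) → Subset (n G) → Set
IsVertexCover G S = ∀ u v → Edge G u v → (u ∈ S) ⊎ (v ∈ S)

IsMinVertexCover : (G : Graph) → Subset (n G) → Set
IsMinVertexCover G S =
  IsVertexCover G S × (∀ T → IsVertexCover G T → ∣ S ∣ ≤ ∣ T ∣)

MinVC : Graph → Set
MinVC G = Σ[ S ∈ Subset (n G) ] IsMinVertexCover G S

-- Vertex set Fin (4 * n); a vertex i corresponds
-- via remQuot to a pair (t , x) with t : Fin 4, x : Fin n:
--   t = 0 : the original vertex x of H
--   t = 1 : the centre c_x of the star attached at x
--   t = 2, 3 : the two degree-one leaves adjacent to c_x
eqF : ∀ {m} → Fin m → Fin m → Bool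
eqF x y = does (x ≟ y)

stAdj' : ∀ {m} → (Fin m → Fin m → Bool) → Fin 4 × Fin m → Fin 4 × Fin m → Bool
stAdj' a (zero , x) (zero , y) = a x y
stAdj' a (zero , x) (suc zero , y) = eqF x y
stAdj' a (suc zero , x) (zero , y) = eqF x y
stAdj' a (suc zero , x) (suc (suc zero) , y) = eqF x y
stAdj' a (suc zero , x) (suc (suc (suc zero)) , y) = eqF x y
stAdj' a (suc (suc zero) , x) (suc zero , y) = eqF x y
stAdj' a (suc (suc (suc zero)) , x) (suc zero , y) = eqF x y
stAdj' a _ _ = false

St : Graph → Graph
St H = graph (4 * n H)
  (λ i j → stAdj' (adj H) (remQuot {4} (n H) i) (remQuot {4} (n H) j))

-- a bijection between two sets of subsets (elements identified by the
-- underlying subset; the minimality proofs are irrelevant)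
record MinVCBijection (G K : Graph) : Set where
  field
    to      : MinVC G → MinVC K
    from    : MinVC K → MinVC G
    from-to : ∀ a → proj₁ (from (to a)) ≡ proj₁ a
    to-from : ∀ b → proj₁ (to (from b)) ≡ proj₁ b

-- A vertex cover T of St(H) meets H in a vertex cover of H, and since every star needs its centre
-- or both of its leaves, |T| ≥ |T ∩ H| + |V(H)|, with equality only when T is T ∩ H together with
-- all the centres.  Hence T ↦ T ∩ H and S ↦ S ∪ {centres} are mutually inverse between minimum
-- covers.
module Submission where

open import Defs
open import Data.Nat using (ℕ; _+_; _*_; _≤_)
open import Data.Nat.Properties
  using (≤-trans; ≤-reflexive; +-identityʳ; +-monoʳ-≤; +-monoˡ-≤; +-cancelˡ-≤; +-cancelʳ-≤;
         m≤m+n; m+[n∸m]≡n; n≤0⇒n≡0; module ≤-Reasoning)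
open import Data.Bool using (Bool; true)
open import Data.Fin using (Fin; zero; suc; combine; remQuot; _≟_)
open import Data.Fin.Properties using (remQuot-combine; combine-remQuot)
open import Data.Fin.Subset using (Subset; inside; outside; _∈_; _⊆_; ∁; ∣_∣; ⊤; ⊥)
open import Data.Fin.Subset.Properties
  using (∣p∣≤n; ∣∁p∣≡n∸∣p∣; ∣p∣≡n⇒p≡⊤; p⊆q⇒∣p∣≤∣q∣; ∣⊤∣≡n; ∣⊥∣≡0; ∈⊤; x∈∁p⇒x∉p)
open import Data.Vec using (Vec; []; _∷_; _++_; concat; group; lookup; map; sum)
open import Data.Vec.Properties
  using (++-injectiveˡ; ++-injectiveʳ; lookup-concat; []=⇒lookup; lookup⇒[]=)
open import Data.Product using (_×_; _,_; proj₁; proj₂; uncurry)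
open import Data.Sum using (_⊎_; inj₁; inj₂) renaming (map to map-⊎)
open import Relation.Nullary.Decidable using (dec-true)
open import Relation.Nullary.Negation using (contradiction)
open import Relation.Binary.PropositionalEquality
  using (_≡_; refl; sym; trans; cong; cong₂; subst; subst₂; module ≡-Reasoning)

∣p++q∣≡∣p∣+∣q∣ : ∀ {m n} (p : Subset m) (q : Subset n) → ∣ p ++ q ∣ ≡ ∣ p ∣ + ∣ q ∣
∣p++q∣≡∣p∣+∣q∣ []            q = refl
∣p++q∣≡∣p∣+∣q∣ (outside ∷ p) q = ∣p++q∣≡∣p∣+∣q∣ p q
∣p++q∣≡∣p∣+∣q∣ (inside  ∷ p) q = cong (1 +_) (∣p++q∣≡∣p∣+∣q∣ p q)

∣concat∣≡sum : ∀ {m k} (ps : Vec (Subset k) m) → ∣ concat ps ∣ ≡ sum (map ∣_∣ ps)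
∣concat∣≡sum []       = refl
∣concat∣≡sum (p ∷ ps) = trans (∣p++q∣≡∣p∣+∣q∣ p (concat ps)) (cong (∣ p ∣ +_) (∣concat∣≡sum ps))

∣p∣≡0⇒p≡⊥ : ∀ {n} {p : Subset n} → ∣ p ∣ ≡ 0 → p ≡ ⊥
∣p∣≡0⇒p≡⊥ {p = []}          _  = refl
∣p∣≡0⇒p≡⊥ {p = outside ∷ p} eq = cong (outside ∷_) (∣p∣≡0⇒p≡⊥ eq)
∣p∣≡0⇒p≡⊥ {p = inside  ∷ p} ()

∣p∣+∣∁p∣≡n : ∀ {n} (p : Subset n) → ∣ p ∣ + ∣ ∁ p ∣ ≡ n
∣p∣+∣∁p∣≡n p = trans (cong (∣ p ∣ +_) (∣∁p∣≡n∸∣p∣ p)) (m+[n∸m]≡n (∣p∣≤n p))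

∁-cover-size : ∀ {n} {p q : Subset n} → ∁ p ⊆ q → n ≤ ∣ p ∣ + ∣ q ∣
∁-cover-size {p = p} ∁p⊆q = subst₂ _≤_ (∣p∣+∣∁p∣≡n p) refl (+-monoʳ-≤ ∣ p ∣ (p⊆q⇒∣p∣≤∣q∣ ∁p⊆q))

∁-cover-tight : ∀ {n} {p q r : Subset n} → ∁ p ⊆ q → ∁ p ⊆ r →
                ∣ p ∣ + (∣ q ∣ + ∣ r ∣) ≤ n → p ≡ ⊤ × q ≡ ⊥ × r ≡ ⊥
∁-cover-tight {n} {p} {q} {r} ∁p⊆q ∁p⊆r small =
  ∣p∣≡n⇒p≡⊤ ∣p∣≡n , ∣p∣≡0⇒p≡⊥ ∣q∣≡0 , ∣p∣≡0⇒p≡⊥ ∣r∣≡0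
  where
  k = ∣ ∁ p ∣
  k≤∣q∣ : k ≤ ∣ q ∣
  k≤∣q∣ = p⊆q⇒∣p∣≤∣q∣ ∁p⊆q
  k≤∣r∣ : k ≤ ∣ r ∣
  k≤∣r∣ = p⊆q⇒∣p∣≤∣q∣ ∁p⊆r
  ∣q∣+∣r∣≤k : ∣ q ∣ + ∣ r ∣ ≤ k
  ∣q∣+∣r∣≤k = +-cancelˡ-≤ ∣ p ∣ _ _ (subst₂ _≤_ refl (sym (∣p∣+∣∁p∣≡n p)) small)
  ∣q∣≡0 : ∣ q ∣ ≡ 0
  ∣q∣≡0 = n≤0⇒n≡0 (+-cancelʳ-≤ ∣ r ∣ ∣ q ∣ 0 (≤-trans ∣q∣+∣r∣≤k k≤∣r∣))
  ∣r∣≡0 : ∣ r ∣ ≡ 0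
  ∣r∣≡0 = n≤0⇒n≡0 (+-cancelˡ-≤ ∣ q ∣ ∣ r ∣ 0
            (subst₂ _≤_ refl (sym (+-identityʳ ∣ q ∣)) (≤-trans ∣q∣+∣r∣≤k k≤∣q∣)))
  ∣p∣≡n : ∣ p ∣ ≡ n
  ∣p∣≡n = begin
    ∣ p ∣           ≡⟨ sym (+-identityʳ ∣ p ∣) ⟩
    ∣ p ∣ + 0       ≡⟨ cong (∣ p ∣ +_) (sym (n≤0⇒n≡0 (subst₂ _≤_ refl ∣q∣≡0 k≤∣q∣))) ⟩
    ∣ p ∣ + k       ≡⟨ ∣p∣+∣∁p∣≡n p ⟩
    n               ∎
    where open ≡-Reasoning

concat-injective : ∀ {a} {A : Set a} {m k} (xss yss : Vec (Vec A k) m) →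
                   concat xss ≡ concat yss → xss ≡ yss
concat-injective []         []         _  = refl
concat-injective (xs ∷ xss) (ys ∷ yss) eq =
  cong₂ _∷_ (++-injectiveˡ xs ys eq) (concat-injective xss yss (++-injectiveʳ xs ys eq))

∈-concat⁺ : ∀ {m k} {ps : Vec (Subset k) m} {t x} → x ∈ lookup ps t → combine t x ∈ concat ps
∈-concat⁺ {ps = ps} {t} {x} x∈p = lookup⇒[]= _ _ (trans (lookup-concat ps t x) ([]=⇒lookup x∈p))

∈-concat⁻ : ∀ {m k} {ps : Vec (Subset k) m} {t x} → combine t x ∈ concat ps → x ∈ lookup ps t
∈-concat⁻ {ps = ps} {t} {x} tx∈ = lookup⇒[]= _ _ (trans (sym (lookup-concat ps t x)) ([]=⇒lookup tx∈))

stAdj'-cases : ∀ {m} (a : Fin m → Fin m → Bool) t x s y → stAdj' a (t , x) (s , y) ≡ true →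
               (t ≡ zero × s ≡ zero × a x y ≡ true) ⊎ (t ≡ suc zero ⊎ s ≡ suc zero)
stAdj'-cases a zero                   x zero                   y e  = inj₁ (refl , refl , e)
stAdj'-cases a zero                   x (suc zero)             y _  = inj₂ (inj₂ refl)
stAdj'-cases a (suc zero)             x s                      y _  = inj₂ (inj₁ refl)
stAdj'-cases a (suc (suc zero))       x (suc zero)             y _  = inj₂ (inj₂ refl)
stAdj'-cases a (suc (suc (suc zero))) x (suc zero)             y _  = inj₂ (inj₂ refl)
stAdj'-cases a zero                   x (suc (suc zero))       y ()
stAdj'-cases a zero                   x (suc (suc (suc zero))) y ()
stAdj'-cases a (suc (suc zero))       x zero                   y ()
stAdj'-cases a (suc (suc zero))       x (suc (suc zero))       y ()
stAdj'-cases a (suc (suc zero))       x (suc (suc (suc zero))) y ()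
stAdj'-cases a (suc (suc (suc zero))) x zero                   y ()
stAdj'-cases a (suc (suc (suc zero))) x (suc (suc zero))       y ()
stAdj'-cases a (suc (suc (suc zero))) x (suc (suc (suc zero))) y ()

module StarStudded (H : Graph) where

  m : ℕ
  m = n H

  St-edge⁺ : ∀ t x s y → stAdj' (adj H) (t , x) (s , y) ≡ true →
             Edge (St H) (combine t x) (combine s y)
  St-edge⁺ t x s y =
    subst₂ (λ u v → stAdj' (adj H) u v ≡ true) (sym (remQuot-combine t x)) (sym (remQuot-combine s y))

  St-edge⁻ : ∀ t x s y → Edge (St H) (combine t x) (combine s y) →
             stAdj' (adj H) (t , x) (s , y) ≡ true
  St-edge⁻ t x s y =
    subst₂ (λ u v → stAdj' (adj H) u v ≡ true) (remQuot-combine t x) (remQuot-combine s y)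

  LayerCover : Vec (Subset m) 4 → Set
  LayerCover ps = ∀ t x s y → stAdj' (adj H) (t , x) (s , y) ≡ true →
                  x ∈ lookup ps t ⊎ y ∈ lookup ps s

  layerCover⇒cover : ∀ {ps} → LayerCover ps → IsVertexCover (St H) (concat ps)
  layerCover⇒cover {ps} covers u v =
    subst₂ (λ u v → Edge (St H) u v → u ∈ concat ps ⊎ v ∈ concat ps)
      (combine-remQuot {4} m u) (combine-remQuot {4} m v)
      (covered (remQuot m u) (remQuot m v))
    where
    covered : ∀ tx sy → Edge (St H) (uncurry combine tx) (uncurry combine sy) →
              uncurry combine tx ∈ concat ps ⊎ uncurry combine sy ∈ concat ps
    covered (t , x) (s , y) e =
      map-⊎ (∈-concat⁺ {ps = ps} {t}) (∈-concat⁺ {ps = ps} {s}) (covers t x s y (St-edge⁻ t x s y e))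

  cover⇒layerCover : ∀ {ps} → IsVertexCover (St H) (concat ps) → LayerCover ps
  cover⇒layerCover {ps} vc t x s y e =
    map-⊎ (∈-concat⁻ {ps = ps}) (∈-concat⁻ {ps = ps}) (vc (combine t x) (combine s y) (St-edge⁺ t x s y e))

  extend : Subset m → Subset (4 * m)
  extend S = concat (S ∷ ⊤ ∷ ⊥ ∷ ⊥ ∷ [])

  layers : Subset (4 * m) → Vec (Subset m) 4
  layers T = proj₁ (group 4 m T)

  concat-layers : ∀ T → concat (layers T) ≡ T
  concat-layers T = sym (proj₂ (group 4 m T))

  layers-concat : ∀ ps → layers (concat ps) ≡ ps
  layers-concat ps = sym (concat-injective ps _ (proj₂ (group 4 m (concat ps))))

  core : Subset (4 * m) → Subset m
  core T = lookup (layers T) zero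

  core-extend : ∀ S → core (extend S) ≡ S
  core-extend S = cong (λ ps → lookup ps zero) (layers-concat (S ∷ ⊤ ∷ ⊥ ∷ ⊥ ∷ []))

  ∣layers∣ : ∀ (A B C D : Subset m) → ∣ concat (A ∷ B ∷ C ∷ D ∷ []) ∣ ≡ ∣ A ∣ + (∣ B ∣ + (∣ C ∣ + ∣ D ∣))
  ∣layers∣ A B C D = trans (∣concat∣≡sum (A ∷ B ∷ C ∷ D ∷ []))
    (cong (λ d → ∣ A ∣ + (∣ B ∣ + (∣ C ∣ + d))) (+-identityʳ ∣ D ∣))

  ∣extend∣ : ∀ S → ∣ extend S ∣ ≡ ∣ S ∣ + m
  ∣extend∣ S = begin
    ∣ extend S ∣                                        ≡⟨ ∣layers∣ S ⊤ ⊥ ⊥ ⟩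
    ∣ S ∣ + (∣ ⊤ {m} ∣ + (∣ ⊥ {m} ∣ + ∣ ⊥ {m} ∣))    ≡⟨ cong (λ k → ∣ S ∣ + (∣ ⊤ {m} ∣ + (k + k))) (∣⊥∣≡0 m) ⟩
    ∣ S ∣ + (∣ ⊤ {m} ∣ + 0)                             ≡⟨ cong (λ k → ∣ S ∣ + (k + 0)) (∣⊤∣≡n m) ⟩
    ∣ S ∣ + (m + 0)                                     ≡⟨ cong (∣ S ∣ +_) (+-identityʳ m) ⟩
    ∣ S ∣ + m                                           ∎
    where open ≡-Reasoning

  extend-cover : ∀ {S} → IsVertexCover H S → IsVertexCover (St H) (extend S)
  extend-cover {S} vc = layerCover⇒cover {S ∷ ⊤ ∷ ⊥ ∷ ⊥ ∷ []} covered
    where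
    covered : LayerCover (S ∷ ⊤ ∷ ⊥ ∷ ⊥ ∷ [])
    covered t x s y e with stAdj'-cases (adj H) t x s y e
    ... | inj₁ (refl , refl , xy) = vc x y xy
    ... | inj₂ (inj₁ refl)        = inj₁ ∈⊤
    ... | inj₂ (inj₂ refl)        = inj₂ ∈⊤

  core-cover : ∀ {T} → IsVertexCover (St H) T → IsVertexCover H (core T)
  core-cover {T} vc u v e = cover⇒layerCover {layers T} vc′ zero u zero v e
    where
    vc′ : IsVertexCover (St H) (concat (layers T))
    vc′ = subst (IsVertexCover (St H)) (sym (concat-layers T)) vc

  leaves-forced : ∀ A B C D → IsVertexCover (St H) (concat (A ∷ B ∷ C ∷ D ∷ [])) →
                  ∁ B ⊆ C × ∁ B ⊆ D
  leaves-forced A B C D vc =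
    (λ {x} → forced (suc (suc zero)) (dec-true (x ≟ x) refl)) ,
    (λ {x} → forced (suc (suc (suc zero))) (dec-true (x ≟ x) refl))
    where
    forced : ∀ leaf {x} → stAdj' (adj H) (suc zero , x) (leaf , x) ≡ true →
             x ∈ ∁ B → x ∈ lookup (A ∷ B ∷ C ∷ D ∷ []) leaf
    forced leaf {x} e x∈∁B with cover⇒layerCover {A ∷ B ∷ C ∷ D ∷ []} vc (suc zero) x leaf x e
    ... | inj₁ x∈B    = contradiction x∈B (x∈∁p⇒x∉p x∈∁B)
    ... | inj₂ x∈leaf = x∈leaf

  layered-cover-size : ∀ A B C D → IsVertexCover (St H) (concat (A ∷ B ∷ C ∷ D ∷ [])) →
                       ∣ A ∣ + m ≤ ∣ concat (A ∷ B ∷ C ∷ D ∷ []) ∣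
  layered-cover-size A B C D vc = begin
    ∣ A ∣ + m                                ≤⟨ +-monoʳ-≤ ∣ A ∣ (∁-cover-size (proj₁ (leaves-forced A B C D vc))) ⟩
    ∣ A ∣ + (∣ B ∣ + ∣ C ∣)                  ≤⟨ +-monoʳ-≤ ∣ A ∣ (+-monoʳ-≤ ∣ B ∣ (m≤m+n ∣ C ∣ ∣ D ∣)) ⟩
    ∣ A ∣ + (∣ B ∣ + (∣ C ∣ + ∣ D ∣))        ≡⟨ ∣layers∣ A B C D ⟨
    ∣ concat (A ∷ B ∷ C ∷ D ∷ []) ∣          ∎
    where open ≤-Reasoning

  layered-cover-tight : ∀ A B C D → IsVertexCover (St H) (concat (A ∷ B ∷ C ∷ D ∷ [])) →
                        ∣ concat (A ∷ B ∷ C ∷ D ∷ []) ∣ ≤ ∣ A ∣ + m →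
                        concat (A ∷ B ∷ C ∷ D ∷ []) ≡ extend A
  layered-cover-tight A B C D vc large
    with ∁-cover-tight (proj₁ (leaves-forced A B C D vc)) (proj₂ (leaves-forced A B C D vc))
           (+-cancelˡ-≤ ∣ A ∣ _ _ (subst (_≤ ∣ A ∣ + m) (∣layers∣ A B C D) large))
  ... | refl , refl , refl = refl

  layers-elim : (P : Vec (Subset m) 4 → Subset (4 * m) → Set) → (∀ ps → P ps (concat ps)) →
                ∀ T → P (layers T) T
  layers-elim P p T = subst (P (layers T)) (concat-layers T) (p (layers T))

  cover-size : ∀ {T} → IsVertexCover (St H) T → ∣ core T ∣ + m ≤ ∣ T ∣
  cover-size {T} = layers-elim (λ ps T → IsVertexCover (St H) T → ∣ lookup ps zero ∣ + m ≤ ∣ T ∣)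
    (λ { (A ∷ B ∷ C ∷ D ∷ []) → layered-cover-size A B C D }) T

  cover-tight : ∀ {T} → IsVertexCover (St H) T → ∣ T ∣ ≤ ∣ core T ∣ + m → T ≡ extend (core T)
  cover-tight {T} = layers-elim
    (λ ps T → IsVertexCover (St H) T → ∣ T ∣ ≤ ∣ lookup ps zero ∣ + m → T ≡ extend (lookup ps zero))
    (λ { (A ∷ B ∷ C ∷ D ∷ []) → layered-cover-tight A B C D }) T

lemma3p10 : (H : Graph) → IsSimple H → Connected H → Bipartite H →
    MinVCBijection H (St H)
lemma3p10 H _ _ _ = record { to = to ; from = from ; from-to = from-to ; to-from = to-from }
  where
  open StarStudded H

  to : MinVC H → MinVC (St H)
  to (S , vc , min) = extend S , extend-cover vc , λ T vcT → begin
    ∣ extend S ∣     ≡⟨ ∣extend∣ S ⟩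
    ∣ S ∣ + m        ≤⟨ +-monoˡ-≤ m (min (core T) (core-cover vcT)) ⟩
    ∣ core T ∣ + m   ≤⟨ cover-size vcT ⟩
    ∣ T ∣            ∎
    where open ≤-Reasoning

  from : MinVC (St H) → MinVC H
  from (T , vc , min) = core T , core-cover vc , λ S vcS → +-cancelʳ-≤ m _ _ (begin
    ∣ core T ∣ + m   ≤⟨ cover-size vc ⟩
    ∣ T ∣            ≤⟨ min (extend S) (extend-cover vcS) ⟩
    ∣ extend S ∣     ≡⟨ ∣extend∣ S ⟩
    ∣ S ∣ + m        ∎)
    where open ≤-Reasoning

  from-to : ∀ a → proj₁ (from (to a)) ≡ proj₁ a
  from-to (S , _) = core-extend S

  to-from : ∀ b → proj₁ (to (from b)) ≡ proj₁ b
  to-from (T , vc , min) = sym (cover-tight vc (≤-trans (min _ (extend-cover (core-cover vc)))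
                                                        (≤-reflexive (∣extend∣ (core T)))))
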